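{- Let $C=(S,f)$ be a classifier model, $s\in S$, $X\subseteq \mathit{Atm}\setminus\mathit{Dec}$, and $\varphi,\psi\in\mathcal{L}(\mathit{Atm})$. Then $(C,s)\models \varphi\Rightarrow_X\psi$ if and only if $$(C,s)\models \bigwedge_{0\le k\le |X|}\Big(\mathsf{MaxProx}(\varphi,X,k)\rightarrow \bigwedge_{Y\subseteq X:\,|Y|=k}[Y](\varphi\rightarrow\psi)\Big),$$ where $\mathsf{MaxProx}(\varphi,X,k)=\bigvee_{Y\subseteq X:\,|Y|=k}\langle Y\rangle\varphi\ \wedge \bigwedge_{Y\subseteq X:\,k<|Y|}[Y]\neg\varphi$.
   Context: $\mathit{Atm}$ is a finite set of atomic propositions containing the decision atoms $\mathit{Dec}=\{\mathsf{t}(x):x\in\mathit{Val}\}$, $\mathit{Val}$ a finite set of decision values. The language $\mathcal{L}(\mathit{Atm})$ is $\varphi::=p\mid\neg\varphi\mid\varphi\wedge\varphi\mid[X]\varphi$ with $p\in\mathit{Atm}$, $X\subseteq\mathit{Atm}$; $\langle X\rangle\varphi:=\neg[X]\neg\varphi$, other connectives as usual. A classifier model is $C=(S,f)$ with $S=2^{\mathit{Atm}\setminus\mathit{Dec}}$, $f:S\to\mathit{Val}$. Truth at $(C,s)$: for $p\in\mathit{Atm}\setminus\mathit{Dec}$, $p$ is true iff $p\in s$; $\mathsf{t}(x)$ is true iff $f(s)=x$; Boolean clauses as usual; $[X]\varphi$ is true iff $(C,s')\models\varphi$ for all $s'\in S$ with $s\cap X=s'\cap X$. Let $\|\varphi\|_C=\{s\in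 S:(C,s)\models\varphi\}$. For $s,s'\in S$, the similarity $\sigma_X(s,s')=|\{p\in X:(C,s)\models p\text{ iff }(C,s')\models p\}|$. Define $\mathrm{Closest}_X(s,\varphi)=\arg\max_{s'\in\|\varphi\|_C}\sigma_X(s,s')$ (empty if $\|\varphi\|_C=\emptyset$), and $(C,s)\models\varphi\Rightarrow_X\psi$ iff $\mathrm{Closest}_X(s,\varphi)\subseteq\|\psi\|_C$. -}

module Defs where

open import Data.Nat using (ℕ; zero; suc; _<?_; _≤_)
open import Data.Nat.Properties using () renaming (_≟_ to _≟ℕ_)
open import Data.Bool using (Bool; true; false; not; _xor_)
open import Data.Fin using (Fin; zero)
open import Data.Fin.Subset using (Subset; _∈_; _⊆_; _∩_; ∣_∣; inside; outside)
open import Data.Fin.Subset.Properties using (_⊆?_)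
open import Data.Vec using (Vec; []; _∷_; tabulate)
open import Data.List using (List; []; _∷_; map; _++_; filter; foldr; upTo)
open import Data.Product using (_×_; _,_)
open import Relation.Nullary using (¬_)
open import Relation.Nullary.Decidable using (_×-dec_)
open import Relation.Binary.PropositionalEquality using (_≡_)

-- Atoms: n non-decision atoms (Atm \ Dec) and decision atoms t(x), x ∈ Val = Fin (suc m).
-- (Val is nonempty: f : S → Val with S = 2^(Atm\Dec) ≠ ∅ forces this.)
data Atm (n m : ℕ) : Set where
  var : Fin n → Atm n m
  t   : Fin (suc m) → Atm n m

AtmSet : ℕ → ℕ → Set
AtmSet n m = Atm n m → Bool

data Fml (n m : ℕ) : Set where
  atom : Atm n m → Fml n m
  ¬'_  : Fml n m → Fml n m
  _∧'_ : Fml n m → Fml n m → Fml n m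
  [_]_ : AtmSet n m → Fml n m → Fml n m

infixr 6 _∧'_
infix 7 ¬'_

module _ {n m : ℕ} where
  ⊤' : Fml n m
  ⊤' = ¬' (atom (t zero) ∧' ¬' atom (t zero))

  ⊥' : Fml n m
  ⊥' = ¬' ⊤'

  _∨'_ : Fml n m → Fml n m → Fml n m
  φ ∨' ψ = ¬' (¬' φ ∧' ¬' ψ)

  _⇒'_ : Fml n m → Fml n m → Fml n m
  φ ⇒' ψ = ¬' (φ ∧' ¬' ψ)

  ⟨_⟩_ : AtmSet n m → Fml n m → Fml n m
  ⟨ X ⟩ φ = ¬' ([ X ] (¬' φ))

  ⋀ : List (Fml n m) → Fml n m
  ⋀ = foldr _∧'_ ⊤'

  ⋁ : List (Fml n m) → Fml n m
  ⋁ = foldr _∨'_ ⊥'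

emb : ∀ {n m} → Subset n → AtmSet n m
emb Y (var p) = Data.Vec.lookup Y p
emb Y (t x)   = false

restr : ∀ {n m} → AtmSet n m → Subset n
restr X = tabulate (λ p → X (var p))

State : ℕ → Set
State n = Subset n

record Classifier (n m : ℕ) : Set where
  field
    f : State n → Fin (suc m)
open Classifier public

_,_⊨_ : ∀ {n m} → Classifier n m → State n → Fml n m → Set
C , s ⊨ atom (var p) = p ∈ s
C , s ⊨ atom (t x)   = f C s ≡ x
C , s ⊨ (¬' φ)       = ¬ (C , s ⊨ φ)
C , s ⊨ (φ ∧' ψ)     = (C , s ⊨ φ) × (C , s ⊨ ψ)
C , s ⊨ ([ X ] φ)    = ∀ s' → s ∩ restr X ≡ s' ∩ restr X → C , s' ⊨ φ

σ : ∀ {n} → Subset n → State n → State n → ℕ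
σ X s s' = ∣ X ∩ tabulate (λ p → not (Data.Vec.lookup s p xor Data.Vec.lookup s' p)) ∣

Closest : ∀ {n m} → Classifier n m → Subset n → State n → Fml n m → State n → Set
Closest C X s φ s' = (C , s' ⊨ φ) × (∀ s'' → C , s'' ⊨ φ → σ X s s'' ≤ σ X s s')

CF : ∀ {n m} → Classifier n m → State n → Subset n → Fml n m → Fml n m → Set
CF C s X φ ψ = ∀ s' → Closest C X s φ s' → C , s' ⊨ ψ

allSubsets : (n : ℕ) → List (Subset n)
allSubsets zero    = [] ∷ []
allSubsets (suc n) = map (outside ∷_) (allSubsets n) ++ map (inside ∷_) (allSubsets n)

subsetsEq : ∀ {n} → Subset n → ℕ → List (Subset n)
subsetsEq {n} X k = filter (λ Y → (Y ⊆? X) ×-dec (∣ Y ∣ ≟ℕ k)) (allSubsets n)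

subsetsGt : ∀ {n} → Subset n → ℕ → List (Subset n)
subsetsGt {n} X k = filter (λ Y → (Y ⊆? X) ×-dec (k <? ∣ Y ∣)) (allSubsets n)

MaxProx : ∀ {n m} → Fml n m → Subset n → ℕ → Fml n m
MaxProx φ X k =
  ⋁ (map (λ Y → ⟨ emb Y ⟩ φ) (subsetsEq X k))
  ∧' ⋀ (map (λ Y → [ emb Y ] (¬' φ)) (subsetsGt X k))

cfFormula : ∀ {n m} → Fml n m → Subset n → Fml n m → Fml n m
cfFormula φ X ψ =
  ⋀ (map (λ k → MaxProx φ X k ⇒' ⋀ (map (λ Y → [ emb Y ] (φ ⇒' ψ)) (subsetsEq X k)))
         (upTo (suc ∣ X ∣)))

{-# OPTIONS --safe #-}
module Submission where

-- Write A for the set of atoms of X on which s and s' agree, so σ X s s' = ∣A∣. For Y ⊆ X,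
-- s' agrees with s on Y iff Y ⊆ A; hence ⟨Y⟩φ for some ∣Y∣ = k and [Y]¬φ for all ∣Y∣ > k
-- (MaxProx) say precisely that k is the largest similarity of a φ-state to s. A closest
-- φ-state s' therefore has σ X s s' = k with MaxProx at k, and agrees with s on A, ∣A∣ = k;
-- conversely, under MaxProx at k every φ-state agreeing with s on some ∣Y∣ = k is closest.

open import Defs
open import Data.Nat using (ℕ; suc; _≤_; _<_; _<?_; s≤s)
open import Data.Nat.Properties using (≤-trans; ≮⇒≥; <⇒≱) renaming (_≟_ to _≟ℕ_)
open import Data.Fin.Subset using (Subset; _⊆_; _∩_; ∣_∣; inside; outside)
open import Data.Fin.Subset.Properties using (_⊆?_; _∈?_; p⊆q⇒∣p∣≤∣q∣; p∩q⊆p; drop-∷-⊆; anySubset?)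
open import Data.Fin.Properties using () renaming (_≟_ to _≟F_)
open import Data.Bool using (true; false; not; _xor_; _∧_) renaming (_≟_ to _≟B_)
open import Data.Bool.Properties using (∧-zeroʳ)
open import Data.Vec using ([]; _∷_; tabulate; lookup; head; tail; here; there)
open import Data.Vec.Properties using (tabulate∘lookup; ≡-dec)
open import Data.List using ([]; _∷_; map; upTo)
open import Data.List.Membership.Propositional using () renaming (_∈_ to _∈L_)
open import Data.List.Membership.Propositional.Properties using (∈-map⁺; ∈-++⁺ˡ; ∈-++⁺ʳ; ∈-upTo⁺; ∈-filter⁺; ∈-filter⁻)
open import Data.List.Relation.Unary.Any using (here; there)
open import Data.Product using (_×_; _,_; proj₂)
open import Relation.Nullary using (Dec; yes; no; ¬?)
open import Relation.Nullary.Decidable using (_×-dec_; _→-dec_; decidable-stable)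
open import Relation.Nullary.Negation using (¬∃⟶∀¬)
open import Level using (0ℓ)
open import Relation.Unary using (Pred; Decidable)
open import Relation.Binary.PropositionalEquality using (_≡_; refl; sym; cong; cong₂; subst)
open import Function.Bundles using (_⇔_; mk⇔)

AgreeOn : ∀ {n} → Subset n → State n → State n → Set
AgreeOn Y s s' = s ∩ Y ≡ s' ∩ Y

-- σ X s s' is literally ∣ agreement X s s' ∣.
agreement : ∀ {n} → Subset n → State n → State n → Subset n
agreement X s s' = X ∩ tabulate (λ p → not (lookup s p xor lookup s' p))

agreement⊆ : ∀ {n} (X s s' : Subset n) → agreement X s s' ⊆ X
agreement⊆ X s s' = p∩q⊆p X _

∧-agree : ∀ x a b → a ∧ (x ∧ not (a xor b)) ≡ b ∧ (x ∧ not (a xor b))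
∧-agree x false false = refl
∧-agree x true  true  = refl
∧-agree x false true  = sym (∧-zeroʳ x)
∧-agree x true  false = ∧-zeroʳ x

AgreeOn-agreement : ∀ {n} (X s s' : Subset n) → AgreeOn (agreement X s s') s s'
AgreeOn-agreement []      []      []        = refl
AgreeOn-agreement (x ∷ X) (a ∷ s) (b ∷ s') = cong₂ _∷_ (∧-agree x a b) (AgreeOn-agreement X s s')

⊆-agreement : ∀ {n} {X Y s s' : Subset n} → Y ⊆ X → AgreeOn Y s s' → Y ⊆ agreement X s s'
⊆-agreement {X = x ∷ X} {true ∷ Y} {a ∷ s} {b ∷ s'} Y⊆X agree here with Y⊆X here | a | b | cong head agree
... | here | false | false | _ = here
... | here | true  | true  | _ = here
⊆-agreement {X = x ∷ X} {y ∷ Y} {a ∷ s} {b ∷ s'} Y⊆X agree (there p∈Y) =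
  there (⊆-agreement (drop-∷-⊆ Y⊆X) (cong tail agree) p∈Y)

∣∣≤σ : ∀ {n} {X Y s s' : Subset n} → Y ⊆ X → AgreeOn Y s s' → ∣ Y ∣ ≤ σ X s s'
∣∣≤σ Y⊆X agree = p⊆q⇒∣p∣≤∣q∣ (⊆-agreement Y⊆X agree)

σ≤∣∣ : ∀ {n} (X s s' : Subset n) → σ X s s' ≤ ∣ X ∣
σ≤∣∣ X s s' = p⊆q⇒∣p∣≤∣q∣ (agreement⊆ X s s')

allSubsets? : ∀ {n} {P : Pred (Subset n) 0ℓ} → Decidable P → Dec (∀ s → P s)
allSubsets? P? with anySubset? (λ s → ¬? (P? s))
... | yes (s , ¬Ps) = no λ ∀P → ¬Ps (∀P s)
... | no  ¬∃¬P      = yes λ s → decidable-stable (P? s) (¬∃⟶∀¬ ¬∃¬P s)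

∈-allSubsets : ∀ {n} (Y : Subset n) → Y ∈L allSubsets n
∈-allSubsets []            = here refl
∈-allSubsets (outside ∷ Y) = ∈-++⁺ˡ (∈-map⁺ (outside ∷_) (∈-allSubsets Y))
∈-allSubsets (inside ∷ Y) = ∈-++⁺ʳ _ (∈-map⁺ (inside ∷_) (∈-allSubsets Y))

module _ {n : ℕ} {X Y : Subset n} {k : ℕ} where
  ∈-subsetsEq⁺ : Y ⊆ X → ∣ Y ∣ ≡ k → Y ∈L subsetsEq X k
  ∈-subsetsEq⁺ Y⊆X ∣Y∣≡k = ∈-filter⁺ (λ Y → (Y ⊆? X) ×-dec (∣ Y ∣ ≟ℕ k)) (∈-allSubsets Y) (Y⊆X , ∣Y∣≡k)

  ∈-subsetsEq⁻ : Y ∈L subsetsEq X k → Y ⊆ X × ∣ Y ∣ ≡ k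
  ∈-subsetsEq⁻ Y∈ = proj₂ (∈-filter⁻ (λ Y → (Y ⊆? X) ×-dec (∣ Y ∣ ≟ℕ k)) {xs = allSubsets n} Y∈)

  ∈-subsetsGt⁺ : Y ⊆ X → k < ∣ Y ∣ → Y ∈L subsetsGt X k
  ∈-subsetsGt⁺ Y⊆X k<∣Y∣ = ∈-filter⁺ (λ Y → (Y ⊆? X) ×-dec (k <? ∣ Y ∣)) (∈-allSubsets Y) (Y⊆X , k<∣Y∣)

  ∈-subsetsGt⁻ : Y ∈L subsetsGt X k → Y ⊆ X × k < ∣ Y ∣
  ∈-subsetsGt⁻ Y∈ = proj₂ (∈-filter⁻ (λ Y → (Y ⊆? X) ×-dec (k <? ∣ Y ∣)) {xs = allSubsets n} Y∈)

module Semantics {n m : ℕ} (C : Classifier n m) where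

  ⊨? : ∀ s (φ : Fml n m) → Dec (C , s ⊨ φ)
  ⊨? s (atom (var p)) = p ∈? s
  ⊨? s (atom (t x))   = f C s ≟F x
  ⊨? s (¬' φ)         = ¬? (⊨? s φ)
  ⊨? s (φ ∧' ψ)       = ⊨? s φ ×-dec ⊨? s ψ
  ⊨? s ([ X ] φ)      = allSubsets? λ s' → ≡-dec _≟B_ (s ∩ restr X) (s' ∩ restr X) →-dec ⊨? s' φ

  module _ {s : State n} where
    ⊨[emb]⁻ : ∀ Y φ {s'} → C , s ⊨ ([ emb Y ] φ) → AgreeOn Y s s' → C , s' ⊨ φ
    ⊨[emb]⁻ Y φ {s'} □φ agree = □φ s' (subst (λ Z → AgreeOn Z s s') (sym (tabulate∘lookup Y)) agree)

    ⊨[emb]⁺ : ∀ Y φ → (∀ s' → AgreeOn Y s s' → C , s' ⊨ φ) → C , s ⊨ ([ emb Y ] φ)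
    ⊨[emb]⁺ Y φ h s' agree = h s' (subst (λ Z → AgreeOn Z s s') (tabulate∘lookup Y) agree)

    module _ {B : Set} (g : B → Fml n m) where
      ⊨⋀⁻ : ∀ {l x} → C , s ⊨ (⋀ (map g l)) → x ∈L l → C , s ⊨ g x
      ⊨⋀⁻ (gx , _)    (here refl) = gx
      ⊨⋀⁻ (_  , ⋀gl)  (there x∈l) = ⊨⋀⁻ ⋀gl x∈l

      ⊨⋀⁺ : ∀ l → (∀ {x} → x ∈L l → C , s ⊨ g x) → C , s ⊨ (⋀ (map g l))
      ⊨⋀⁺ []      h = λ (⊤ , ¬⊤) → ¬⊤ ⊤
      ⊨⋀⁺ (x ∷ l) h = h (here refl) , ⊨⋀⁺ l (λ x∈l → h (there x∈l))

      ⊨⋁⁺ : ∀ {l x} → x ∈L l → C , s ⊨ g x → C , s ⊨ (⋁ (map g l))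
      ⊨⋁⁺ (here refl) gx = λ (¬gx , _) → ¬gx gx
      ⊨⋁⁺ (there x∈l) gx = λ (_ , ¬⋁gl) → ¬⋁gl (⊨⋁⁺ x∈l gx)

  module _ {X : Subset n} {s : State n} {φ : Fml n m} where
    MaxProx⇒σ≤ : ∀ {k s'} → C , s ⊨ (MaxProx φ X k) → C , s' ⊨ φ → σ X s s' ≤ k
    MaxProx⇒σ≤ {s' = s'} (_ , noneBeyond) φs' = ≮⇒≥ λ k<σ →
      ⊨[emb]⁻ (agreement X s s') (¬' φ) (⊨⋀⁻ _ noneBeyond (∈-subsetsGt⁺ (agreement⊆ X s s') k<σ))
        (AgreeOn-agreement X s s') φs'

    MaxProx⇒Closest : ∀ {k Y s'} → C , s ⊨ (MaxProx φ X k) → Y ⊆ X → ∣ Y ∣ ≡ k → AgreeOn Y s s'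
                    → C , s' ⊨ φ → Closest C X s φ s'
    MaxProx⇒Closest mp Y⊆X ∣Y∣≡k agree φs' =
      φs' , λ s'' φs'' → ≤-trans (MaxProx⇒σ≤ mp φs'') (subst (_≤ _) ∣Y∣≡k (∣∣≤σ Y⊆X agree))

    Closest⇒MaxProx : ∀ {s'} → Closest C X s φ s' → C , s ⊨ (MaxProx φ X (σ X s s'))
    Closest⇒MaxProx {s'} (φs' , maximal) = someAtDistance , noneBeyond
      where
      someAtDistance : C , s ⊨ (⋁ (map (λ Y → ⟨ emb Y ⟩ φ) (subsetsEq X (σ X s s'))))
      someAtDistance = ⊨⋁⁺ _ (∈-subsetsEq⁺ (agreement⊆ X s s') refl)
        λ □¬φ → ⊨[emb]⁻ (agreement X s s') (¬' φ) □¬φ (AgreeOn-agreement X s s') φs'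

      noneBeyond : C , s ⊨ (⋀ (map (λ Y → [ emb Y ] (¬' φ)) (subsetsGt X (σ X s s'))))
      noneBeyond = ⊨⋀⁺ _ _ λ {Y} Y∈ → ⊨[emb]⁺ Y (¬' φ) λ s'' agree φs'' →
        let Y⊆X , σ<∣Y∣ = ∈-subsetsGt⁻ Y∈
        in <⇒≱ σ<∣Y∣ (≤-trans (∣∣≤σ Y⊆X agree) (maximal s'' φs''))

proposition2 : {n m : ℕ} (C : Classifier n m) (s : State n) (X : Subset n)
    (φ ψ : Fml n m) → CF C s X φ ψ ⇔ (C , s ⊨ cfFormula φ X ψ)
proposition2 {n} {m} C s X φ ψ = mk⇔ sound complete
  where
  open Semantics C

  φ⇒ψOn : Subset n → Fml n m
  φ⇒ψOn Y = [ emb Y ] (φ ⇒' ψ)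

  atDistance : ℕ → Fml n m
  atDistance k = MaxProx φ X k ⇒' ⋀ (map φ⇒ψOn (subsetsEq X k))

  sound : CF C s X φ ψ → C , s ⊨ cfFormula φ X ψ
  sound cf = ⊨⋀⁺ atDistance (upTo (suc ∣ X ∣)) λ _ (mp , ¬conclusion) →
    ¬conclusion (⊨⋀⁺ φ⇒ψOn _ λ {Y} Y∈ → ⊨[emb]⁺ Y (φ ⇒' ψ) λ s' agree (φs' , ¬ψs') →
      let Y⊆X , ∣Y∣≡k = ∈-subsetsEq⁻ Y∈
      in ¬ψs' (cf s' (MaxProx⇒Closest mp Y⊆X ∣Y∣≡k agree φs')))

  -- [Y](φ ⇒' ψ) only yields ¬ ¬ ψ at s', so truth must be decidable.
  complete : C , s ⊨ cfFormula φ X ψ → CF C s X φ ψ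
  complete H s' closest@(φs' , _) = decidable-stable (⊨? s' ψ) λ ¬ψs' →
    ⊨⋀⁻ atDistance H (∈-upTo⁺ (s≤s (σ≤∣∣ X s s'))) (Closest⇒MaxProx closest , λ conclusion →
      ⊨[emb]⁻ (agreement X s s') (φ ⇒' ψ)
        (⊨⋀⁻ φ⇒ψOn conclusion (∈-subsetsEq⁺ (agreement⊆ X s s') refl))
        (AgreeOn-agreement X s s') (φs' , ¬ψs'))
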